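{- Let $h\ge1$ and let $H(h)$ be the half graph with color classes $\{u_1,\ldots,u_h\}$ and $\{v_1,\ldots,v_h\}$, where $u_i$ is adjacent to $v_j$ if and only if $j\le h-i+1$. Let $(a_1,\ldots,a_6)=(1,0,-1,-1,0,1)$ and define $x_i=a_s$ whenever $i\equiv s\pmod 6$, $1\le s\le 6$, for $i=1,\dots,h$. Let $\mathbf{y}$ be the vector on $V(H(h))$ given by $\mathbf{y}(u_i)=\mathbf{y}(v_i)=x_i$ for $i=1,\ldots,h$. Then $\mathbf{y}$ is an eigenvector of the adjacency matrix of $H(h)$ for the eigenvalue $1$ if $h\equiv1\pmod 6$, and for the eigenvalue $-1$ if $h\equiv 4\pmod 6$.
   Context: The half graph $H(h)$ is the chain graph with all cells of size one, i.e. the bipartite graph described in the claim; its eigenvalues and eigenvectors are those of its adjacency matrix. -}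

module Defs where

open import Data.Nat using (ℕ; zero; suc; _<?_; _%_; _≡ᵇ_)
import Data.Nat as ℕ
open import Data.Fin using (Fin; toℕ)
import Data.Fin
open import Data.Sum using (_⊎_; inj₁; inj₂)
open import Data.Integer using (ℤ; +_; -_; _+_; _*_)
open import Data.Bool using (Bool; true; false; if_then_else_)
open import Data.Product using (_×_; ∃)
open import Relation.Nullary using (¬_)
open import Relation.Nullary.Decidable using (does)
open import Relation.Binary.PropositionalEquality using (_≡_)

-- Vertices of the half graph H(h): inj₁ i is u_{i+1}, inj₂ j is v_{j+1}
-- (0-based indices i, j : Fin h).
Vertex : ℕ → Set
Vertex h = Fin h ⊎ Fin h

-- u_i ~ v_j iff j ≤ h - i + 1 (1-based), i.e. with 0-based a = i-1, b = j-1: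
-- b + 1 ≤ h - a, i.e. a + b < h.
halfAdj : (h : ℕ) → Fin h → Fin h → Bool
halfAdj h a b = does ((toℕ a ℕ.+ toℕ b) <? h)

adjMatrix : (h : ℕ) → Vertex h → Vertex h → ℤ
adjMatrix h (inj₁ a) (inj₂ b) = if halfAdj h a b then + 1 else + 0
adjMatrix h (inj₂ b) (inj₁ a) = if halfAdj h a b then + 1 else + 0
adjMatrix h (inj₁ _) (inj₁ _) = + 0
adjMatrix h (inj₂ _) (inj₂ _) = + 0

sumFin : (n : ℕ) → (Fin n → ℤ) → ℤ
sumFin zero    f = + 0
sumFin (suc n) f = f Data.Fin.zero + sumFin n (λ i → f (Data.Fin.suc i))

sumV : (h : ℕ) → (Vertex h → ℤ) → ℤ
sumV h f = sumFin h (λ i → f (inj₁ i)) + sumFin h (λ j → f (inj₂ j))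

mulVec : (h : ℕ) → (Vertex h → Vertex h → ℤ) → (Vertex h → ℤ) → Vertex h → ℤ
mulVec h M y w = sumV h (λ z → M w z * y z)

IsEigenvector : (h : ℕ) → (Vertex h → Vertex h → ℤ) → ℤ → (Vertex h → ℤ) → Set
IsEigenvector h M λ' y =
  (¬ (∀ w → y w ≡ + 0)) × (∀ w → mulVec h M y w ≡ λ' * y w)

-- (a_1,…,a_6) = (1,0,-1,-1,0,1); x_i = a_s where i ≡ s (mod 6), 1 ≤ s ≤ 6.
-- With 1-based i: (i - 1) % 6 = 0,1,2,3,4,5 ↦ 1,0,-1,-1,0,1.
aSeq : ℕ → ℤ
aSeq 0 = + 1
aSeq 1 = + 0
aSeq 2 = - (+ 1)
aSeq 3 = - (+ 1)
aSeq 4 = + 0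
aSeq _ = + 1

xVal : ℕ → ℤ
xVal i = aSeq ((i ℕ.∸ 1) % 6)

yVec : (h : ℕ) → Vertex h → ℤ
yVec h (inj₁ a) = xVal (suc (toℕ a))
yVec h (inj₂ b) = xVal (suc (toℕ b))

module Submission where

-- Since y(u_i) = y(v_i) and u_i ~ v_j iff i + j ≤ h + 1, the u_i- and v_i-entries of
-- A y both equal the partial sum x_1 + ⋯ + x_{h+1-i}. Now x_1 + ⋯ + x_n = x_{n+5},
-- x is antiperiodic with period 3, and x_i = x_j whenever i + j ≡ 1 (mod 6). For h ≡ 1
-- this turns x_{h+6-i} into x_i, and for h ≡ 4 it turns -x_{h+3-i} into -x_i.

open import Defs
open import Data.Nat using (ℕ; zero; suc; _≥_; _≤_; _<_; _∸_; _%_; _/_; _<?_; s≤s)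
import Data.Nat as ℕ
open import Data.Nat.Properties using (+-comm; +-∸-assoc; m∸n≤m; m≤n+m; ≤-trans; <⇒≤)
open import Data.Nat.DivMod using (m≡m%n+[m/n]*n; [m+kn]%n≡m%n)
open import Data.Fin using (toℕ)
import Data.Fin as Fin
open import Data.Fin.Properties using (toℕ<n)
open import Data.Integer using (ℤ; +_; -_; _+_; _*_)
open import Data.Integer.Properties using (+-assoc; +-identityˡ; +-identityʳ; *-identityˡ; -1*i≡-i)
open import Data.Bool using (Bool; if_then_else_)
open import Data.Sum using (inj₁; inj₂)
open import Data.Product using (_×_; _,_)
open import Relation.Nullary using (¬_)
open import Relation.Nullary.Decidable using (does)
open import Relation.Binary.PropositionalEquality
open ≡-Reasoning

sumBelow : ℕ → (ℕ → ℤ) → ℤ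
sumBelow zero    g = + 0
sumBelow (suc n) g = g 0 + sumBelow n (λ b → g (suc b))

sumFin-toℕ : ∀ n (g : ℕ → ℤ) → sumFin n (λ i → g (toℕ i)) ≡ sumBelow n g
sumFin-toℕ zero    g = refl
sumFin-toℕ (suc n) g = cong (_+_ (g 0)) (sumFin-toℕ n (λ b → g (suc b)))

sumBelow-zeros : ∀ n → sumBelow n (λ _ → + 0) ≡ + 0
sumBelow-zeros zero    = refl
sumBelow-zeros (suc n) = cong (_+_ (+ 0)) (sumBelow-zeros n)

sumFin-zeros : ∀ n → sumFin n (λ _ → + 0) ≡ + 0
sumFin-zeros n = trans (sumFin-toℕ n (λ _ → + 0)) (sumBelow-zeros n)

sumBelow-cong : ∀ n {f g : ℕ → ℤ} → (∀ b → f b ≡ g b) → sumBelow n f ≡ sumBelow n g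
sumBelow-cong zero    f≗g = refl
sumBelow-cong (suc n) f≗g = cong₂ _+_ (f≗g 0) (sumBelow-cong n (λ b → f≗g (suc b)))

sumBelow-+ : ∀ m n (g : ℕ → ℤ) → sumBelow (m ℕ.+ n) g ≡ sumBelow m g + sumBelow n (λ b → g (m ℕ.+ b))
sumBelow-+ zero    n g = sym (+-identityˡ _)
sumBelow-+ (suc m) n g = begin
  g 0 + sumBelow (m ℕ.+ n) (λ b → g (suc b))
    ≡⟨ cong (_+_ (g 0)) (sumBelow-+ m n (λ b → g (suc b))) ⟩
  g 0 + (sumBelow m (λ b → g (suc b)) + sumBelow n (λ b → g (suc m ℕ.+ b)))
    ≡⟨ sym (+-assoc (g 0) _ _) ⟩
  g 0 + sumBelow m (λ b → g (suc b)) + sumBelow n (λ b → g (suc m ℕ.+ b)) ∎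

𝟙 : Bool → ℤ
𝟙 t = if t then + 1 else + 0

sumBelow-truncate : ∀ n m (g : ℕ → ℤ) → m ≤ n →
                    sumBelow n (λ b → 𝟙 (does (b <? m)) * g b) ≡ sumBelow m g
sumBelow-truncate n       zero    g _         = sumBelow-zeros n
sumBelow-truncate (suc n) (suc m) g (s≤s m≤n) =
  cong₂ _+_ (*-identityˡ (g 0)) (sumBelow-truncate n m (λ b → g (suc b)) m≤n)

does-+<-∸ : ∀ c b n → does (c ℕ.+ b <? n) ≡ does (b <? n ∸ c)
does-+<-∸ zero    b n       = refl
does-+<-∸ (suc c) b zero    = refl
does-+<-∸ (suc c) b (suc n) = does-+<-∸ c b n

halfAdj-rowSum : ∀ h c (g : ℕ → ℤ) →
                 sumBelow h (λ b → 𝟙 (does (c ℕ.+ b <? h)) * g b) ≡ sumBelow (h ∸ c) g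
halfAdj-rowSum h c g = begin
  sumBelow h (λ b → 𝟙 (does (c ℕ.+ b <? h)) * g b)
    ≡⟨ sumBelow-cong h (λ b → cong (λ t → 𝟙 t * g b) (does-+<-∸ c b h)) ⟩
  sumBelow h (λ b → 𝟙 (does (b <? h ∸ c)) * g b)
    ≡⟨ sumBelow-truncate h (h ∸ c) g (m∸n≤m h c) ⟩
  sumBelow (h ∸ c) g ∎

index : ∀ {h} → Vertex h → ℕ
index (inj₁ a) = toℕ a
index (inj₂ b) = toℕ b

symVec : (h : ℕ) → (ℕ → ℤ) → Vertex h → ℤ
symVec h g w = g (index w)

adjMatrix-mulVec-symVec : ∀ h (g : ℕ → ℤ) (w : Vertex h) →
                          mulVec h (adjMatrix h) (symVec h g) w ≡ sumBelow (h ∸ index w) g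
adjMatrix-mulVec-symVec h g (inj₁ a) = begin
  sumFin h (λ _ → + 0) + sumFin h (λ j → 𝟙 (halfAdj h a j) * g (toℕ j))
    ≡⟨ cong₂ _+_ (sumFin-zeros h) (sumFin-toℕ h (λ b → 𝟙 (does (toℕ a ℕ.+ b <? h)) * g b)) ⟩
  + 0 + sumBelow h (λ b → 𝟙 (does (toℕ a ℕ.+ b <? h)) * g b)
    ≡⟨ +-identityˡ _ ⟩
  sumBelow h (λ b → 𝟙 (does (toℕ a ℕ.+ b <? h)) * g b)
    ≡⟨ halfAdj-rowSum h (toℕ a) g ⟩
  sumBelow (h ∸ toℕ a) g ∎
adjMatrix-mulVec-symVec h g (inj₂ a) = begin
  sumFin h (λ i → 𝟙 (halfAdj h i a) * g (toℕ i)) + sumFin h (λ _ → + 0)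
    ≡⟨ cong₂ _+_ (sumFin-toℕ h (λ b → 𝟙 (does (b ℕ.+ toℕ a <? h)) * g b)) (sumFin-zeros h) ⟩
  sumBelow h (λ b → 𝟙 (does (b ℕ.+ toℕ a <? h)) * g b) + + 0
    ≡⟨ +-identityʳ _ ⟩
  sumBelow h (λ b → 𝟙 (does (b ℕ.+ toℕ a <? h)) * g b)
    ≡⟨ sumBelow-cong h (λ b → cong (λ k → 𝟙 (does (k <? h)) * g b) (+-comm b (toℕ a))) ⟩
  sumBelow h (λ b → 𝟙 (does (toℕ a ℕ.+ b <? h)) * g b)
    ≡⟨ halfAdj-rowSum h (toℕ a) g ⟩
  sumBelow (h ∸ toℕ a) g ∎

x₀ : ℕ → ℤ
x₀ b = xVal (suc b)

x₀-periodic : ∀ r q → x₀ (r ℕ.+ q ℕ.* 6) ≡ x₀ r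
x₀-periodic r q = cong aSeq ([m+kn]%n≡m%n r q 6)

x₀-antiperiodic : ∀ m → x₀ (3 ℕ.+ m) ≡ - x₀ m
x₀-antiperiodic 0 = refl
x₀-antiperiodic 1 = refl
x₀-antiperiodic 2 = refl
x₀-antiperiodic 3 = refl
x₀-antiperiodic 4 = refl
x₀-antiperiodic 5 = refl
x₀-antiperiodic (suc (suc (suc (suc (suc (suc m)))))) = x₀-antiperiodic m

x₀-reflect : ∀ q i → i ≤ 5 ℕ.+ q ℕ.* 6 → x₀ (5 ℕ.+ q ℕ.* 6 ∸ i) ≡ x₀ i
x₀-reflect q 0 _ = x₀-periodic 5 q
x₀-reflect q 1 _ = x₀-periodic 4 q
x₀-reflect q 2 _ = x₀-periodic 3 q
x₀-reflect q 3 _ = x₀-periodic 2 q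
x₀-reflect q 4 _ = x₀-periodic 1 q
x₀-reflect q 5 _ = x₀-periodic 0 q
x₀-reflect zero    (suc (suc (suc (suc (suc (suc i)))))) (s≤s (s≤s (s≤s (s≤s (s≤s ())))))
x₀-reflect (suc q) (suc (suc (suc (suc (suc (suc i)))))) (s≤s (s≤s (s≤s (s≤s (s≤s (s≤s i≤))))))
  = x₀-reflect q i i≤

sumBelow-x₀ : ∀ n → sumBelow n x₀ ≡ x₀ (4 ℕ.+ n)
sumBelow-x₀ 0 = refl
sumBelow-x₀ 1 = refl
sumBelow-x₀ 2 = refl
sumBelow-x₀ 3 = refl
sumBelow-x₀ 4 = refl
sumBelow-x₀ 5 = refl
sumBelow-x₀ (suc (suc (suc (suc (suc (suc n)))))) =
  trans (sumBelow-+ 6 n x₀) (trans (+-identityˡ _) (sumBelow-x₀ n))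

x₀-reflect-shift : ∀ s q {h} i → s ℕ.+ h ≡ 5 ℕ.+ q ℕ.* 6 → i ≤ h → x₀ (s ℕ.+ (h ∸ i)) ≡ x₀ i
x₀-reflect-shift s q {h} i s+h≡ i≤h = begin
  x₀ (s ℕ.+ (h ∸ i))       ≡⟨ cong x₀ (sym (+-∸-assoc s i≤h)) ⟩
  x₀ (s ℕ.+ h ∸ i)         ≡⟨ cong (λ k → x₀ (k ∸ i)) s+h≡ ⟩
  x₀ (5 ℕ.+ q ℕ.* 6 ∸ i)   ≡⟨ x₀-reflect q i (subst (i ≤_) s+h≡ (≤-trans i≤h (m≤n+m h s))) ⟩
  x₀ i                     ∎

%6-decompose : ∀ {h r} → h % 6 ≡ r → h ≡ r ℕ.+ h / 6 ℕ.* 6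
%6-decompose {h} h%6≡r = trans (m≡m%n+[m/n]*n h 6) (cong (ℕ._+ h / 6 ℕ.* 6) h%6≡r)

sumBelow-x₀-reflect₁ : ∀ {h} → h % 6 ≡ 1 → ∀ i → i ≤ h → sumBelow (h ∸ i) x₀ ≡ x₀ i
sumBelow-x₀-reflect₁ {h} h≡1 i i≤h = begin
  sumBelow (h ∸ i) x₀   ≡⟨ sumBelow-x₀ (h ∸ i) ⟩
  x₀ (4 ℕ.+ (h ∸ i))    ≡⟨ x₀-reflect-shift 4 (h / 6) i (cong (4 ℕ.+_) (%6-decompose h≡1)) i≤h ⟩
  x₀ i                  ∎

sumBelow-x₀-reflect₄ : ∀ {h} → h % 6 ≡ 4 → ∀ i → i ≤ h → sumBelow (h ∸ i) x₀ ≡ - x₀ i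
sumBelow-x₀-reflect₄ {h} h≡4 i i≤h = begin
  sumBelow (h ∸ i) x₀   ≡⟨ sumBelow-x₀ (h ∸ i) ⟩
  x₀ (4 ℕ.+ (h ∸ i))    ≡⟨ x₀-antiperiodic (1 ℕ.+ (h ∸ i)) ⟩
  - x₀ (1 ℕ.+ (h ∸ i))  ≡⟨ cong -_ (x₀-reflect-shift 1 (h / 6) i (cong (1 ℕ.+_) (%6-decompose h≡4)) i≤h) ⟩
  - x₀ i                ∎

yVec-eigenvector : ∀ h λ′ → h ≥ 1 → (∀ i → i < h → sumBelow (h ∸ i) x₀ ≡ λ′ * x₀ i) →
                   IsEigenvector h (adjMatrix h) λ′ (yVec h)
yVec-eigenvector (suc h) λ′ _ rows = yVec≢0 , eigen
  where
  yVec≢0 : ¬ (∀ w → yVec (suc h) w ≡ + 0)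
  yVec≢0 y≡0 with y≡0 (inj₁ Fin.zero)
  ... | ()
  eigen : ∀ w → mulVec (suc h) (adjMatrix (suc h)) (yVec (suc h)) w ≡ λ′ * yVec (suc h) w
  eigen (inj₁ a) = trans (adjMatrix-mulVec-symVec (suc h) x₀ (inj₁ a)) (rows (toℕ a) (toℕ<n a))
  eigen (inj₂ b) = trans (adjMatrix-mulVec-symVec (suc h) x₀ (inj₂ b)) (rows (toℕ b) (toℕ<n b))

theorem3p7 : (h : ℕ) → h ≥ 1 →
    ((h % 6 ≡ 1 → IsEigenvector h (adjMatrix h) (+ 1) (yVec h)) ×
     (h % 6 ≡ 4 → IsEigenvector h (adjMatrix h) (- (+ 1)) (yVec h)))
theorem3p7 h h≥1 =
  (λ h≡1 → yVec-eigenvector h (+ 1) h≥1 λ i i<h →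
     trans (sumBelow-x₀-reflect₁ h≡1 i (<⇒≤ i<h)) (sym (*-identityˡ (x₀ i)))) ,
  (λ h≡4 → yVec-eigenvector h (- (+ 1)) h≥1 λ i i<h →
     trans (sumBelow-x₀-reflect₄ h≡4 i (<⇒≤ i<h)) (sym (-1*i≡-i (x₀ i))))
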